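{- Consider the Dirichlet eigenvalue problem $\Delta u + \lambda u = 0$ in $D = (0,\pi)\times(0,\pi)$, $u = 0$ on $\partial D$. (i) For every integer $k \ge 1$ there exists an eigenvalue $N$ whose multiplicity is $2k$; in fact one can take $N = p_1 p_2^{k-1}$, where $p_1, p_2$ are distinct primes with $p_1 \equiv p_2 \equiv 1 \pmod 4$. (ii) For every integer $k \ge 1$ there exists an eigenvalue $M$ whose multiplicity is $2k+1$; in fact one can take $M = 2p^{2k}$, where $p$ is a prime with $p \equiv 1 \pmod 4$.
   Context: The eigenvalues of this problem are exactly the numbers $\lambda = n^2 + m^2$ with $n, m$ positive integers, with eigenfunctions $\sin(nx)\sin(my)$. The multiplicity of an eigenvalue $\lambda$ is the dimension of its eigenspace, which equals the number of ordered pairs $(n,m)$ of positive integers with $n^2 + m^2 = \lambda$. -}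

module Defs where

open import Data.Nat using (ℕ; suc; _+_; _*_; _≟_; _≤_)
open import Data.Product using (_×_; _,_; proj₁; proj₂; ∃-syntax)
open import Data.List using (List; map; upTo; filter; length; cartesianProduct)
open import Relation.Binary.PropositionalEquality using (_≡_)

-- Dirichlet eigenvalues of the square (0,π)×(0,π): λ = n² + m², n m ≥ 1,
-- eigenfunctions sin(nx) sin(my).
IsEigenvalue : ℕ → Set
IsEigenvalue L = ∃[ n ] ∃[ m ] (1 ≤ n × 1 ≤ m × n * n + m * m ≡ L)

-- candidate values 1, …, L (any positive n with n² + m² = L has n ≤ L)
positivesUpTo : ℕ → List ℕ
positivesUpTo L = map suc (upTo L)

multiplicity : ℕ → ℕ
multiplicity L =
  length (filter (λ p → proj₁ p * proj₁ p + proj₂ p * proj₂ p ≟ L)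
                 (cartesianProduct (positivesUpTo L) (positivesUpTo L)))

{-# OPTIONS --safe #-}

-- When N is not a
-- square no solution lies on an axis, so the multiplicity is a quarter of r(N), the number of
-- Gaussian integers of norm N.
--
-- Let p ≡ 1 (mod 4) be prime. Zagier's involution on the windmills x² + 4yz = p has exactly one
-- fixed point, so there is an odd number of windmills and the involution (x, y, z) ↦ (x, z, y)
-- has a fixed point too: p = a² + b² = π π̄ with π = a + bi. Every w of norm p n is divisible by
-- π or by π̄; sorting these w by whether π̄ ∣ w gives r(p n) = r(n) + s(n), where s(n) counts the
-- w of norm n with π̄ ∤ w. Likewise s(p n) = s(n), and s(n) = r(n) when p ∤ n. Starting from
-- r(1) = s(1) = 4 this gives r(p^k) = 4 (k + 1) and r(p₁ p₂^k) = 2 r(p₂^k) = 8 (k + 1); and as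
-- 1 + i has norm 2 and is associate to 1 - i, r(2 p^{2k}) = r(p^{2k}) = 4 (2k + 1).

module Submission where

module Enumerations where

  open import Data.Nat.Base using (ℕ; zero; suc; _+_; _*_)
  open import Data.Nat.Properties using (suc-injective; *-suc)
  open import Data.Product.Base using (∃; ∃-syntax; _×_; _,_; proj₁)
  open import Data.Sum.Base using (_⊎_; inj₁; inj₂; [_,_]′)
  open import Data.List.Base using (List; []; _∷_; _++_; map; length; filter)
  open import Data.List.Properties using (length-++; length-map; filter-all)
  open import Data.List.Membership.Propositional using (_∈_)
  open import Data.List.Membership.Propositional.Properties
    using (∈-++⁺ˡ; ∈-++⁺ʳ; ∈-++⁻; ∈-map⁺; ∈-map⁻; ∈-filter⁺; ∈-filter⁻)
  open import Data.List.Membership.Propositional.Properties.WithK using (unique∧set⇒bag)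
  open import Data.List.Relation.Binary.BagAndSetEquality using (∼bag⇒↭)
  open import Data.List.Relation.Binary.Permutation.Propositional.Properties using (↭-length)
  open import Data.List.Relation.Unary.Any using (here; there)
  import Data.List.Relation.Unary.All as All
  open import Data.List.Relation.Unary.AllPairs using (_∷_)
  open import Data.List.Relation.Unary.Unique.Propositional using (Unique)
  import Data.List.Relation.Unary.Unique.Propositional.Properties as Unique
  open import Function.Base using (_∘_)
  open import Function.Bundles using (mk⇔)
  open import Function.Definitions using (Injective)
  open import Relation.Nullary using (¬_; ¬?; yes; no; contradiction)
  open import Relation.Binary.Definitions using (DecidableEquality)
  open import Relation.Binary.PropositionalEquality using (_≡_; _≢_; refl; sym; trans; cong; cong₂; ≢-sym)

  record Enumeration {A : Set} (P : A → Set) (n : ℕ) : Set where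
    field
      elements : List A
      unique   : Unique elements
      size     : length elements ≡ n
      sound    : ∀ {a} → a ∈ elements → P a
      complete : ∀ {a} → P a → a ∈ elements

  open Enumeration

  module _ {A : Set} {P : A → Set} where

    size-unique : ∀ {m n} → Enumeration P m → Enumeration P n → m ≡ n
    size-unique e f = trans (sym (size e)) (trans (↭-length elements↭) (size f))
      where
      elements↭ = ∼bag⇒↭ (unique∧set⇒bag (unique e) (unique f)
                    (mk⇔ (λ a∈e → complete f (sound e a∈e)) (λ a∈f → complete e (sound f a∈f))))

    witness : ∀ {n} → Enumeration P (suc n) → ∃ P
    witness e with elements e | sound e | size e
    ... | a ∷ _ | sound-e | _ = a , sound-e (here refl)

  module _ {A : Set} {P Q : A → Set} where

    enumeration-⇔ : ∀ {n} → (∀ {a} → P a → Q a) → (∀ {a} → Q a → P a) →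
                    Enumeration P n → Enumeration Q n
    enumeration-⇔ P⇒Q Q⇒P e = record
      { elements = elements e ; unique = unique e ; size = size e
      ; sound = λ a∈e → P⇒Q (sound e a∈e) ; complete = λ q → complete e (Q⇒P q) }

    enumeration-⊎ : ∀ {m n} → (∀ {a} → P a → ¬ Q a) →
                    Enumeration P m → Enumeration Q n → Enumeration (λ a → P a ⊎ Q a) (m + n)
    enumeration-⊎ disjoint e f = record
      { elements = elements e ++ elements f
      ; unique   = Unique.++⁺ (unique e) (unique f)
                     λ (a∈e , a∈f) → disjoint (sound e a∈e) (sound f a∈f)
      ; size     = trans (length-++ (elements e)) (cong₂ _+_ (size e) (size f))
      ; sound    = λ a∈ → [ (λ a∈e → inj₁ (sound e a∈e)) , (λ a∈f → inj₂ (sound f a∈f)) ]′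
                            (∈-++⁻ (elements e) a∈)
      ; complete = [ (λ p → ∈-++⁺ˡ (complete e p)) , (λ q → ∈-++⁺ʳ (elements e) (complete f q)) ]′
      }

  Image : {A B : Set} → (A → B) → (A → Set) → (B → Set)
  Image f P b = ∃[ a ] (P a × f a ≡ b)

  enumeration-image : ∀ {A B : Set} {P : A → Set} {n} (f : A → B) → Injective _≡_ _≡_ f →
                      Enumeration P n → Enumeration (Image f P) n
  enumeration-image f f-inj e = record
    { elements = map f (elements e)
    ; unique   = Unique.map⁺ f-inj (unique e)
    ; size     = trans (length-map f (elements e)) (size e)
    ; sound    = λ b∈ → let (a , a∈e , b≡fa) = ∈-map⁻ f b∈ in a , sound e a∈e , sym b≡fa
    ; complete = λ { (a , p , refl) → ∈-map⁺ f (complete e p) }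
    }

  enumeration-empty : ∀ {A : Set} {P : A → Set} {a} → Enumeration P 0 → ¬ P a
  enumeration-empty e pa with elements e | complete e pa | size e
  ... | [] | () | _

  module _ {A : Set} (_≟_ : DecidableEquality A) where

    private
      length-remove : ∀ {a} xs → Unique xs → a ∈ xs →
                      length xs ≡ suc (length (filter (λ b → ¬? (b ≟ a)) xs))
      length-remove {a} (x ∷ xs) (x∉xs ∷ xs-unique) a∈x∷xs with x ≟ a | a∈x∷xs
      ... | yes refl | _ = cong (suc ∘ length) (sym (filter-all (λ b → ¬? (b ≟ x)) (All.map ≢-sym x∉xs)))
      ... | no x≢a | here a≡x = contradiction (sym a≡x) x≢a
      ... | no _ | there a∈xs = cong suc (length-remove xs xs-unique a∈xs)

    enumeration-remove : ∀ {P : A → Set} {n a} → Enumeration P (suc n) → P a →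
                         Enumeration (λ b → P b × b ≢ a) n
    enumeration-remove {a = a} e pa = record
      { elements = filter ≢a? (elements e)
      ; unique   = Unique.filter⁺ ≢a? (unique e)
      ; size     = suc-injective
                     (trans (sym (length-remove (elements e) (unique e) (complete e pa))) (size e))
      ; sound    = λ b∈ → let b∈e , b≢a = ∈-filter⁻ ≢a? {xs = elements e} b∈ in sound e b∈e , b≢a
      ; complete = λ (pb , b≢a) → ∈-filter⁺ ≢a? (complete e pb) b≢a
      }
      where ≢a? = λ b → ¬? (b ≟ a)

    involution-even : ∀ {P : A → Set} n → Enumeration P n → (σ : A → A) →
                      (∀ {a} → P a → P (σ a)) → (∀ {a} → P a → σ (σ a) ≡ a) → (∀ {a} → P a → σ a ≢ a) →
                      ∃[ m ] n ≡ 2 * m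
    involution-even zero _ _ _ _ _ = 0 , refl
    involution-even {P} (suc n) e σ closed involutive free with witness e
    ... | a , pa with n | enumeration-remove e pa
    ...   | zero | e′ = contradiction (closed pa , free pa) (enumeration-empty e′)
    ...   | suc n′ | e′ with involution-even n′ (enumeration-remove e′ (closed pa , free pa)) σ
                              closed′ (involutive ∘ proj₁ ∘ proj₁) (free ∘ proj₁ ∘ proj₁)
      where
      closed′ : ∀ {b} → (P b × b ≢ a) × b ≢ σ a → (P (σ b) × σ b ≢ a) × σ b ≢ σ a
      closed′ ((pb , b≢a) , b≢σa) =
        (closed pb , λ σb≡a → b≢σa (trans (sym (involutive pb)) (cong σ σb≡a))) ,
        λ σb≡σa → b≢a (trans (sym (involutive pb)) (trans (cong σ σb≡σa) (involutive pa)))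
    ...   | m , n′≡2m = suc m , sym (trans (*-suc 2 m) (cong (2 +_) (sym n′≡2m)))

module Arithmetic where

  open import Data.Nat.Base using (ℕ; zero; suc; _+_; _*_; _^_; _≤_; _%_; s≤s; z≤n)
  open import Data.Nat.Properties
    using (*-comm; *-cancelˡ-≡; *-identityʳ; <-irrefl; m≤m*n; m<m+n; module ≤-Reasoning)
  open import Data.Nat.Divisibility using (_∣_; divides; ∣⇒≤; ∣1⇒≡1)
  open import Data.Nat.Primality
    using (Prime; euclidsLemma; prime⇒irreducible; prime⇒nonZero; ¬prime[1]; prime[2])
  open import Data.Nat.Tactic.RingSolver using (solve-∀)
  open import Data.Sum.Base as Sum using (inj₁; inj₂)
  open import Relation.Nullary using (¬_; contradiction)
  open import Relation.Binary.PropositionalEquality using (_≡_; _≢_; refl; sym; trans; subst)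

  NonSquare : ℕ → Set
  NonSquare n = ∀ x → x * x ≢ n

  prime*∤⇒nonSquare : ∀ {q m} → Prime q → ¬ (q ∣ m) → NonSquare (q * m)
  prime*∤⇒nonSquare {q} {m} q-prime q∤m x x²≡qm
    with Sum.reduce (euclidsLemma x x q-prime (divides m (trans x²≡qm (*-comm q m))))
  ... | divides t refl =
    q∤m (divides (t * t) (*-cancelˡ-≡ m (t * t * q) q (trans (sym x²≡qm) (regroup t q))))
    where
    instance _ = prime⇒nonZero q-prime
    regroup : ∀ t q → t * q * (t * q) ≡ q * (t * t * q)
    regroup = solve-∀

  prime∤1 : ∀ {q} → Prime q → ¬ (q ∣ 1)
  prime∤1 q-prime q∣1 = ¬prime[1] (subst Prime (∣1⇒≡1 q∣1) q-prime)

  prime⇒nonSquare : ∀ {p} → Prime p → NonSquare p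
  prime⇒nonSquare {p} p-prime x =
    subst (λ n → x * x ≢ n) (*-identityʳ p) (prime*∤⇒nonSquare p-prime (prime∤1 p-prime) x)

  prime∣prime^⇒≡ : ∀ {q r} → Prime q → Prime r → ∀ j → q ∣ r ^ j → q ≡ r
  prime∣prime^⇒≡ q-prime r-prime zero q∣1 = contradiction q∣1 (prime∤1 q-prime)
  prime∣prime^⇒≡ {q} {r} q-prime r-prime (suc j) q∣r^[1+j]
    with euclidsLemma r (r ^ j) q-prime q∣r^[1+j]
  ... | inj₂ q∣r^j = prime∣prime^⇒≡ q-prime r-prime j q∣r^j
  ... | inj₁ q∣r with prime⇒irreducible r-prime q∣r
  ...   | inj₁ q≡1 = contradiction (subst Prime q≡1 q-prime) ¬prime[1]
  ...   | inj₂ q≡r = q≡r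

  square-summand-∤ : ∀ {p a b} → 1 ≤ a → 1 ≤ b → a * a + b * b ≡ p → ¬ (p ∣ a)
  square-summand-∤ {p} {a@(suc _)} {b@(suc _)} _ _ a²+b²≡p p∣a = <-irrefl refl (begin-strict
    p              ≤⟨ ∣⇒≤ p∣a ⟩
    a              ≤⟨ m≤m*n a a ⟩
    a * a          <⟨ m<m+n (a * a) (s≤s z≤n) ⟩
    a * a + b * b  ≡⟨ a²+b²≡p ⟩
    p              ∎)
    where open ≤-Reasoning

  ≡1mod4⇒∤2 : ∀ {p} → Prime p → p % 4 ≡ 1 → ¬ (p ∣ 2)
  ≡1mod4⇒∤2 p-prime p%4≡1 p∣2 with prime⇒irreducible prime[2] p∣2
  ... | inj₁ refl = ¬prime[1] p-prime
  ... | inj₂ refl with p%4≡1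
  ...   | ()

module MultiplicityEnumeration where

  open import Defs
  open Enumerations
  open import Data.Nat.Base using (ℕ; suc; _+_; _*_; _≤_; s≤s; z≤n)
  open import Data.Nat.Properties using (_≟_; suc-injective; ≤-trans; m≤m+n; m≤m*n; +-comm)
  open import Data.Product.Base using (_×_; _,_; proj₁; proj₂)
  open import Data.List.Base using (filter; cartesianProduct)
  open import Data.List.Membership.Propositional using (_∈_)
  open import Data.List.Membership.Propositional.Properties
    using (∈-filter⁺; ∈-filter⁻; ∈-map⁺; ∈-map⁻; ∈-upTo⁺; ∈-cartesianProduct⁺; ∈-cartesianProduct⁻)
  import Data.List.Relation.Unary.Unique.Propositional.Properties as Unique
  open import Relation.Binary.PropositionalEquality using (_≡_; refl; subst)

  PositiveRepresentation : ℕ → ℕ × ℕ → Set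
  PositiveRepresentation L (n , m) = 1 ≤ n × 1 ≤ m × n * n + m * m ≡ L

  ∈-positivesUpTo⁺ : ∀ {n L} → 1 ≤ n → n ≤ L → n ∈ positivesUpTo L
  ∈-positivesUpTo⁺ {suc n} {suc L} _ (s≤s n≤L) = ∈-map⁺ suc (∈-upTo⁺ (s≤s n≤L))

  ∈-positivesUpTo⁻ : ∀ {n L} → n ∈ positivesUpTo L → 1 ≤ n
  ∈-positivesUpTo⁻ n∈ with ∈-map⁻ suc n∈
  ... | _ , _ , refl = s≤s z≤n

  n≤n*n+m*m : ∀ {n} m → 1 ≤ n → n ≤ n * n + m * m
  n≤n*n+m*m {suc n} m _ = ≤-trans (m≤m*n (suc n) (suc n)) (m≤m+n (suc n * suc n) (m * m))

  multiplicity-enumeration : ∀ L → Enumeration (PositiveRepresentation L) (multiplicity L)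
  multiplicity-enumeration L = record
    { elements = filter isRepresentation? pairs
    ; unique   = Unique.filter⁺ isRepresentation?
                   (Unique.cartesianProduct⁺ positives-unique positives-unique)
    ; size     = refl
    ; sound    = λ {(n , m)} p∈ →
        let p∈pairs , n²+m²≡L = ∈-filter⁻ isRepresentation? {xs = pairs} p∈
            n∈ , m∈ = ∈-cartesianProduct⁻ (positivesUpTo L) (positivesUpTo L) p∈pairs
        in ∈-positivesUpTo⁻ n∈ , ∈-positivesUpTo⁻ m∈ , n²+m²≡L
    ; complete = λ {(n , m)} (1≤n , 1≤m , n²+m²≡L) → ∈-filter⁺ isRepresentation?
        (∈-cartesianProduct⁺
          (∈-positivesUpTo⁺ 1≤n (subst (n ≤_) n²+m²≡L (n≤n*n+m*m m 1≤n)))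
          (∈-positivesUpTo⁺ 1≤m (subst (m ≤_) (subst (_≡ L) (+-comm (n * n) (m * m)) n²+m²≡L)
                                             (n≤n*n+m*m n 1≤m))))
        n²+m²≡L
    }
    where
    isRepresentation? = λ (p : ℕ × ℕ) → proj₁ p * proj₁ p + proj₂ p * proj₂ p ≟ L
    pairs = cartesianProduct (positivesUpTo L) (positivesUpTo L)
    positives-unique = Unique.map⁺ suc-injective (Unique.upTo⁺ L)

  multiplicity-suc⇒eigenvalue : ∀ {L c} → multiplicity L ≡ suc c → IsEigenvalue L
  multiplicity-suc⇒eigenvalue {L} mult≡ =
    let (n , m) , representation =
          witness (subst (Enumeration (PositiveRepresentation L)) mult≡ (multiplicity-enumeration L))
    in n , m , representation

module TwoSquares where

  open Enumerations
  open Enumeration using (elements; sound; complete)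
  open MultiplicityEnumeration using (PositiveRepresentation)
  open Arithmetic using (prime⇒nonSquare)
  open import Data.Nat.Base using (ℕ; zero; suc; _+_; _*_; _∸_; _≤_; _<_; _%_; _/_; s≤s; z≤n)
  open import Data.Nat.Properties
    using (_≟_; _<?_; <-cmp; <-irrefl; <⇒≢; ≤-trans; ≤-reflexive; m≤m+n; m≤n+m; m≤m*n; m≤n*m;
           m<m+n; n≤1+n; m≤n⇒∃[o]m+o≡n; m+n∸m≡n; m≢1+n+m; +-comm; +-suc; +-identityʳ; +-cancelˡ-≡;
           *-comm; *-assoc; *-zeroʳ; *-cancelˡ-≡; suc-injective; even≢odd; module ≤-Reasoning)
  open import Data.Nat.DivMod using (m≡m%n+[m/n]*n; m*n%n≡0)
  open import Data.Nat.Divisibility using (divides)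
  open import Data.Nat.Primality using (Prime; prime⇒irreducible)
  open import Data.Nat.Tactic.RingSolver using (solve-∀)
  open import Data.Product.Base using (_×_; _,_; proj₁; proj₂; ∃; ∃-syntax)
  open import Data.Product.Properties using (≡-dec)
  open import Data.Sum.Base using (inj₁; inj₂)
  open import Data.List.Base using (filter; upTo; cartesianProduct)
  open import Data.List.Membership.Propositional using (find; lose)
  open import Data.List.Membership.Propositional.Properties
    using (∈-filter⁺; ∈-filter⁻; ∈-upTo⁺; ∈-cartesianProduct⁺)
  open import Data.List.Relation.Unary.Any using (any?)
  import Data.List.Relation.Unary.Unique.Propositional.Properties as Unique
  open import Relation.Binary.Definitions using (DecidableEquality; tri<; tri≈; tri>)
  open import Function.Base using (_∘_)
  open import Relation.Nullary using (¬_; Dec; yes; no; contradiction)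
  open import Relation.Binary.PropositionalEquality
    using (_≡_; _≢_; refl; sym; trans; cong; cong₂; subst; module ≡-Reasoning)

  Triple : Set
  Triple = ℕ × ℕ × ℕ

  Windmill : ℕ → Triple → Set
  Windmill p (x , y , z) = x * x + 4 * y * z ≡ p

  swap : Triple → Triple
  swap (x , y , z) = x , z , y

  zagier : Triple → Triple
  zagier (x , y , z) with x + z <? y
  ... | yes _ = x + 2 * z , z , y ∸ (x + z)
  ... | no _ with x <? 2 * y
  ...   | yes _ = 2 * y ∸ x , y , x + z ∸ y
  ...   | no _  = x ∸ 2 * y , x + z ∸ y , y

  -- The three regions x < y - z, y - z < x < 2y and 2y < x of the windmill
  -- (x, y, z), with the differences made explicit to avoid truncated subtraction.
  data Region : Triple → Set where
    left   : ∀ x z d → Region (x , suc (x + z + d) , z)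
    middle : ∀ {x y z} e f → x + z ≡ suc (y + e) → 2 * y ≡ suc (x + f) → Region (x , y , z)
    right  : ∀ y z g → Region (suc (2 * y + g) , y , z)

  private
    ≡suc+⇒≮ : ∀ {a b c} → a ≡ suc (b + c) → ¬ (a < b)
    ≡suc+⇒≮ {b = b} {c} refl a<b = <-irrefl refl (≤-trans (s≤s (m≤m+n b c)) (≤-trans (n≤1+n _) a<b))

    ≡suc+⇒∸ : ∀ {a} b {c} → a ≡ suc (b + c) → a ∸ b ≡ suc c
    ≡suc+⇒∸ b {c} refl = trans (cong (_∸ b) (sym (+-suc b c))) (m+n∸m≡n b (suc c))

    2y+g+z≡y+[y+g+z] : ∀ y g z → 2 * y + g + z ≡ y + (y + g + z)
    2y+g+z≡y+[y+g+z] = solve-∀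

  zagier-left : ∀ x z d → zagier (x , suc (x + z + d) , z) ≡ (x + 2 * z , z , suc d)
  zagier-left x z d with x + z <? suc (x + z + d)
  ... | yes _ = cong (λ c → x + 2 * z , z , c) (≡suc+⇒∸ (x + z) refl)
  ... | no x+z≮y = contradiction (s≤s (m≤m+n (x + z) d)) x+z≮y

  zagier-middle : ∀ {x y z} e f → x + z ≡ suc (y + e) → 2 * y ≡ suc (x + f) →
                  zagier (x , y , z) ≡ (suc f , y , suc e)
  zagier-middle {x} {y} {z} e f x+z≡ 2y≡ with x + z <? y
  ... | yes x+z<y = contradiction x+z<y (≡suc+⇒≮ x+z≡)
  ... | no _ with x <? 2 * y
  ...   | yes _ = cong₂ (λ a c → a , y , c) (≡suc+⇒∸ x 2y≡) (≡suc+⇒∸ y x+z≡)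
  ...   | no x≮2y = contradiction (subst (suc x ≤_) (sym 2y≡) (s≤s (m≤m+n x f))) x≮2y

  zagier-right : ∀ y z g → zagier (suc (2 * y + g) , y , z) ≡ (suc g , suc (y + g + z) , y)
  zagier-right y z g with suc (2 * y + g) + z <? y
  ... | yes x+z<y = contradiction x+z<y (≡suc+⇒≮ (cong suc (2y+g+z≡y+[y+g+z] y g z)))
  ... | no _ with suc (2 * y + g) <? 2 * y
  ...   | yes x<2y = contradiction x<2y (≡suc+⇒≮ refl)
  ...   | no _ = cong₂ (λ a b → a , b , y) (≡suc+⇒∸ (2 * y) refl)
                                           (≡suc+⇒∸ y (cong suc (2y+g+z≡y+[y+g+z] y g z)))

  -- (2y - x)² + 4y(x + z - y) = x² + 4yz, with x² + 2x(2y - x) added to both sides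
  -- to stay in ℕ.
  middle-windmill : ∀ {x y z F E} → x + F ≡ 2 * y → y + E ≡ x + z →
                    F * F + 4 * y * E ≡ x * x + 4 * y * z
  middle-windmill {x} {y} {z} {F} {E} x+F≡2y y+E≡x+z = +-cancelˡ-≡ (x * x + 2 * x * F) _ _ (begin
    x * x + 2 * x * F + (F * F + 4 * y * E)  ≡⟨ expand-square x y F E ⟩
    (x + F) * (x + F) + 4 * y * E            ≡⟨ cong (λ a → a * a + 4 * y * E) x+F≡2y ⟩
    2 * y * (2 * y) + 4 * y * E              ≡⟨ factor-4y y E ⟩
    4 * y * (y + E)                          ≡⟨ cong (4 * y *_) y+E≡x+z ⟩
    4 * y * (x + z)                          ≡⟨ factor-4y′ x y z ⟨
    2 * x * (2 * y) + 4 * y * z              ≡⟨ cong (λ a → 2 * x * a + 4 * y * z) x+F≡2y ⟨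
    2 * x * (x + F) + 4 * y * z              ≡⟨ expand-product x y z F ⟨
    x * x + 2 * x * F + (x * x + 4 * y * z)  ∎)
    where
    open ≡-Reasoning
    expand-square : ∀ x y F E →
      x * x + 2 * x * F + (F * F + 4 * y * E) ≡ (x + F) * (x + F) + 4 * y * E
    expand-square = solve-∀
    factor-4y : ∀ y E → 2 * y * (2 * y) + 4 * y * E ≡ 4 * y * (y + E)
    factor-4y = solve-∀
    factor-4y′ : ∀ x y z → 2 * x * (2 * y) + 4 * y * z ≡ 4 * y * (x + z)
    factor-4y′ = solve-∀
    expand-product : ∀ x y z F →
      x * x + 2 * x * F + (x * x + 4 * y * z) ≡ 2 * x * (x + F) + 4 * y * z
    expand-product = solve-∀

  module Windmills {p : ℕ} (p-prime : Prime p) (p≡1mod4 : p % 4 ≡ 1) where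

    k : ℕ
    k = p / 4

    p≡1+4k : p ≡ suc (4 * k)
    p≡1+4k = trans (m≡m%n+[m/n]*n p 4) (cong₂ _+_ p≡1mod4 (*-comm k 4))

    4*≢p : ∀ m → 4 * m ≢ p
    4*≢p m 4m≡p with trans (sym (m*n%n≡0 m 4)) (trans (cong (_% 4) (trans (*-comm m 4) 4m≡p)) p≡1mod4)
    ... | ()

    windmill-x≥1 : ∀ {x y z} → Windmill p (x , y , z) → 1 ≤ x
    windmill-x≥1 {zero} {y} {z} w = contradiction (trans (sym (*-assoc 4 y z)) w) (4*≢p (y * z))
    windmill-x≥1 {suc x} _ = s≤s z≤n

    windmill-y≥1 : ∀ {x y z} → Windmill p (x , y , z) → 1 ≤ y
    windmill-y≥1 {x} {zero} w =
      contradiction (trans (sym (+-identityʳ (x * x))) w) (prime⇒nonSquare p-prime x)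
    windmill-y≥1 {y = suc y} _ = s≤s z≤n

    windmill-z≥1 : ∀ {x y z} → Windmill p (x , y , z) → 1 ≤ z
    windmill-z≥1 {x} {y} {zero} w =
      contradiction (trans (sym (trans (cong (x * x +_) (*-zeroʳ (4 * y))) (+-identityʳ (x * x)))) w)
                    (prime⇒nonSquare p-prime x)
    windmill-z≥1 {z = suc z} _ = s≤s z≤n

    -- The two excluded boundaries: x + z = y makes p a square, x = 2y makes 4 ∣ p.
    region : ∀ {t} → Windmill p t → Region t
    region {x , y , z} w with <-cmp (x + z) y
    ... | tri< x+z<y _ _ with m≤n⇒∃[o]m+o≡n x+z<y
    ...   | d , refl = left x z d
    region {x , y , z} w | tri≈ _ x+z≡y _ =
      contradiction (trans (boundary x z) (trans (cong (λ a → x * x + 4 * a * z) x+z≡y) w))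
                    (prime⇒nonSquare p-prime (x + 2 * z))
      where boundary : ∀ x z → (x + 2 * z) * (x + 2 * z) ≡ x * x + 4 * (x + z) * z
            boundary = solve-∀
    region {x , y , z} w | tri> _ _ y<x+z with m≤n⇒∃[o]m+o≡n y<x+z | <-cmp x (2 * y)
    ... | e , y+e≡ | tri< x<2y _ _ =
      let f , x+f≡ = m≤n⇒∃[o]m+o≡n x<2y in middle e f (sym y+e≡) (sym x+f≡)
    ... | _ | tri≈ _ x≡2y _ =
      contradiction (trans (boundary y z) (trans (cong (λ a → a * a + 4 * y * z) (sym x≡2y)) w))
                    (4*≢p (y * y + y * z))
      where boundary : ∀ y z → 4 * (y * y + y * z) ≡ 2 * y * (2 * y) + 4 * y * z
            boundary = solve-∀
    ... | _ | tri> _ _ 2y<x with m≤n⇒∃[o]m+o≡n 2y<x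
    ...   | g , refl = right y z g

    zagier-windmill : ∀ {t} → Windmill p t → Windmill p (zagier t)
    zagier-windmill {t} w with region {t} w
    ... | left x z d = subst (Windmill p) (sym (zagier-left x z d)) (trans (left-identity x z d) w)
      where left-identity : ∀ x z d → (x + 2 * z) * (x + 2 * z) + 4 * z * suc d ≡
                                      x * x + 4 * suc (x + z + d) * z
            left-identity = solve-∀
    ... | middle {x} {y} {z} e f x+z≡ 2y≡ =
      subst (Windmill p) (sym (zagier-middle e f x+z≡ 2y≡))
        (trans (middle-windmill {x} {y} {z} {suc f} {suc e} (trans (+-suc x f) (sym 2y≡))
                                                             (trans (+-suc y e) (sym x+z≡)))
               w)
    ... | right y z g = subst (Windmill p) (sym (zagier-right y z g)) (trans (right-identity y z g) w)
      where right-identity : ∀ y z g → suc g * suc g + 4 * suc (y + g + z) * y ≡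
                                       suc (2 * y + g) * suc (2 * y + g) + 4 * y * z
            right-identity = solve-∀

    zagier-involutive : ∀ {t} → Windmill p t → zagier (zagier t) ≡ t
    zagier-involutive {t} w with region {t} w
    ... | left x z d with windmill-x≥1 {x} {suc (x + z + d)} {z} w
    ...   | s≤s {n = x′} _ = begin
      zagier (zagier (suc x′ , suc (suc x′ + z + d) , z))
        ≡⟨ cong zagier (zagier-left (suc x′) z d) ⟩
      zagier (suc (x′ + 2 * z) , z , suc d)
        ≡⟨ cong (λ a → zagier (suc a , z , suc d)) (+-comm x′ (2 * z)) ⟩
      zagier (suc (2 * z + x′) , z , suc d)
        ≡⟨ zagier-right z (suc d) x′ ⟩
      (suc x′ , suc (z + x′ + suc d) , z)
        ≡⟨ cong (λ b → suc x′ , b , z) (regroup z x′ d) ⟩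
      (suc x′ , suc (suc x′ + z + d) , z)
        ∎
      where
      open ≡-Reasoning
      regroup : ∀ z x d → suc (z + x + suc d) ≡ suc (suc x + z + d)
      regroup = solve-∀
    zagier-involutive {t} w | middle {x} {y} {z} e f x+z≡ 2y≡
      with windmill-x≥1 {x} {y} {z} w | windmill-z≥1 {x} {y} {z} w
    ... | s≤s {n = x′} _ | s≤s {n = z′} _ =
      trans (cong zagier (zagier-middle e f x+z≡ 2y≡)) (zagier-middle z′ x′ f+e≡ 2y≡′)
      where
      open ≡-Reasoning
      2y≡′ : 2 * y ≡ suc (suc f + x′)
      2y≡′ = trans 2y≡ (cong (suc ∘ suc) (+-comm x′ f))
      f+e≡ : suc f + suc e ≡ suc (y + z′)
      f+e≡ = +-cancelˡ-≡ (x + y) _ _ (begin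
        x + y + (suc f + suc e)    ≡⟨ interchange x y (suc f) (suc e) ⟩
        (x + suc f) + (y + suc e)  ≡⟨ cong₂ _+_ (trans (+-suc x f) (sym 2y≡))
                                                (trans (+-suc y e) (sym x+z≡)) ⟩
        2 * y + (x + suc z′)       ≡⟨ regroup x y z′ ⟩
        x + y + suc (y + z′)       ∎)
        where
        interchange : ∀ x y F E → x + y + (F + E) ≡ (x + F) + (y + E)
        interchange = solve-∀
        regroup : ∀ x y z → 2 * y + (x + suc z) ≡ x + y + suc (y + z)
        regroup = solve-∀
    zagier-involutive {t} w | right y z g with windmill-z≥1 {suc (2 * y + g)} {y} {z} w
    ... | s≤s {n = z′} _ = begin
      zagier (zagier (suc (2 * y + g) , y , suc z′))
        ≡⟨ cong zagier (zagier-right y (suc z′) g) ⟩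
      zagier (suc g , suc (y + g + suc z′) , y)
        ≡⟨ cong (λ b → zagier (suc g , b , y)) (regroup y g z′) ⟩
      zagier (suc g , suc (suc g + y + z′) , y)
        ≡⟨ zagier-left (suc g) y z′ ⟩
      (suc g + 2 * y , y , suc z′)
        ≡⟨ cong (λ a → a , y , suc z′) (commute g y) ⟩
      (suc (2 * y + g) , y , suc z′)
        ∎
      where
      open ≡-Reasoning
      regroup : ∀ y g z → suc (y + g + suc z) ≡ suc (suc g + y + z)
      regroup = solve-∀
      commute : ∀ g y → suc g + 2 * y ≡ suc (2 * y + g)
      commute = solve-∀

    windmill-x<p : ∀ {x y z} → Windmill p (x , y , z) → x < p
    windmill-x<p {x} {y} {z} w
      with windmill-x≥1 {x} {y} {z} w | windmill-y≥1 {x} {y} {z} w | windmill-z≥1 {x} {y} {z} w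
    ... | s≤s _ | s≤s _ | s≤s _ = begin-strict
      x                  ≤⟨ m≤m*n x x ⟩
      x * x              <⟨ m<m+n (x * x) (s≤s z≤n) ⟩
      x * x + 4 * y * z  ≡⟨ w ⟩
      p                  ∎
      where open ≤-Reasoning

    fixed-point : Triple
    fixed-point = 1 , 1 , k

    fixed-point-windmill : Windmill p fixed-point
    fixed-point-windmill = sym p≡1+4k

    -- On the diagonal p = x (x + 4 z), so x = 1 as p is prime.
    diagonal-windmill : ∀ {x z} → Windmill p (x , x , z) → (x , x , z) ≡ fixed-point
    diagonal-windmill {x} {z} w
      with prime⇒irreducible p-prime (divides (x + 4 * z) (trans (sym w) (factor x z)))
      where factor : ∀ x z → x * x + 4 * x * z ≡ (x + 4 * z) * x
            factor = solve-∀
    ... | inj₂ x≡p = contradiction x≡p (<⇒≢ (windmill-x<p {x} {x} {z} w))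
    ... | inj₁ refl = cong (λ c → 1 , 1 , c) (*-cancelˡ-≡ z k 4 (suc-injective (trans w p≡1+4k)))

    zagier-fixed : ∀ {t} → Windmill p t → zagier t ≡ t → t ≡ fixed-point
    zagier-fixed {t} w fixed with region {t} w
    ... | left x z d = contradiction (cong (proj₁ ∘ proj₂) (trans (sym (zagier-left x z d)) fixed))
                                     (λ z≡ → <-irrefl z≡ (s≤s (≤-trans (m≤n+m z x) (m≤m+n (x + z) d))))
    ... | right y z g with windmill-y≥1 {suc (2 * y + g)} {y} {z} w
    ...   | s≤s _ = contradiction (suc-injective (cong proj₁ (trans (sym (zagier-right y z g)) fixed)))
                                  (m≢1+n+m g)
    zagier-fixed {t} w fixed | middle {x} {y} {z} e f x+z≡ 2y≡
      with cong proj₁ fixed′ | cong (proj₂ ∘ proj₂) fixed′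
      where fixed′ = trans (sym (zagier-middle e f x+z≡ 2y≡)) fixed
    ... | refl | refl = subst (λ a → (x , a , z) ≡ fixed-point) (sym y≡x)
                                (diagonal-windmill (subst (λ a → Windmill p (x , a , z)) y≡x w))
      where
      y≡x : y ≡ x
      y≡x = *-cancelˡ-≡ y x 2 (trans 2y≡ (trans (sym (+-suc x f)) (cong (x +_) (sym (+-identityʳ x)))))

    windmill-bounded : ∀ {x y z} → Windmill p (x , y , z) → x ≤ p × y ≤ p × z ≤ p
    windmill-bounded {x} {y} {z} w
      with windmill-x≥1 {x} {y} {z} w | windmill-y≥1 {x} {y} {z} w | windmill-z≥1 {x} {y} {z} w
    ... | s≤s _ | s≤s _ | s≤s _ =
      ≤-trans (m≤m*n x x) (≤-trans (m≤m+n (x * x) (4 * y * z)) (≤-reflexive w)) ,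
      ≤-trans (m≤n*m y 4) (≤-trans (m≤m*n (4 * y) z) 4yz≤p) ,
      ≤-trans (m≤n*m z (4 * y)) 4yz≤p
      where 4yz≤p = ≤-trans (m≤n+m (4 * y * z) (x * x)) (≤-reflexive w)

    windmill? : ∀ t → Dec (Windmill p t)
    windmill? (x , y , z) = x * x + 4 * y * z ≟ p

    windmills : ∃ (Enumeration (Windmill p))
    windmills = _ , record
      { elements = filter windmill? box
      ; unique   = Unique.filter⁺ windmill? (Unique.cartesianProduct⁺ range-unique
                     (Unique.cartesianProduct⁺ range-unique range-unique))
      ; size     = refl
      ; sound    = λ t∈ → proj₂ (∈-filter⁻ windmill? {xs = box} t∈)
      ; complete = λ {(x , y , z)} w →
          let x≤p , y≤p , z≤p = windmill-bounded {x} {y} {z} w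
          in ∈-filter⁺ windmill? (∈-cartesianProduct⁺ (∈-upTo⁺ (s≤s x≤p))
               (∈-cartesianProduct⁺ (∈-upTo⁺ (s≤s y≤p)) (∈-upTo⁺ (s≤s z≤p)))) w
      }
      where
      box = cartesianProduct (upTo (suc p)) (cartesianProduct (upTo (suc p)) (upTo (suc p)))
      range-unique = Unique.upTo⁺ (suc p)

    _≟ₜ_ : DecidableEquality Triple
    _≟ₜ_ = ≡-dec _≟_ (≡-dec _≟_ _≟_)

    -- zagier pairs off the windmills other than fixed-point
    windmills-odd : ∀ {n} → Enumeration (Windmill p) n → ∃[ m ] n ≡ suc (2 * m)
    windmills-odd {zero} e = contradiction fixed-point-windmill (enumeration-empty {a = fixed-point} e)
    windmills-odd {suc n} e =
      let m , n≡2m = involution-even _≟ₜ_ n (enumeration-remove _≟ₜ_ e fixed-point-windmill) zagier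
                       closed (λ {t} → zagier-involutive {t} ∘ proj₁)
                       (λ {t} (w , t≢) zt≡t → t≢ (zagier-fixed {t} w zt≡t))
      in m , cong suc n≡2m
      where
      closed : ∀ {t} → Windmill p t × t ≢ fixed-point → Windmill p (zagier t) × zagier t ≢ fixed-point
      closed {t} (w , t≢) =
        zagier-windmill {t} w , λ zt≡ → t≢ (trans (sym (zagier-involutive {t} w)) (cong zagier zt≡))

    swap-windmill : ∀ {t} → Windmill p t → Windmill p (swap t)
    swap-windmill {x , y , z} w = trans (cong (x * x +_) (commute y z)) w
      where commute : ∀ y z → 4 * z * y ≡ 4 * y * z
            commute = solve-∀

    swap-fixed-windmill : ∃[ x ] ∃[ y ] Windmill p (x , y , y)
    swap-fixed-windmill with windmills
    ... | n , e with any? (λ t → proj₁ (proj₂ t) ≟ proj₂ (proj₂ t)) (elements e)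
    ...   | yes diagonal with find diagonal
    ...     | (x , y , _) , t∈ , refl = x , y , sound e t∈
    swap-fixed-windmill | n , e | no off-diagonal
      with windmills-odd e | involution-even _≟ₜ_ n e swap (λ {t} → swap-windmill {t}) (λ _ → refl) swap-free
      where
      swap-free : ∀ {t} → Windmill p t → swap t ≢ t
      swap-free {t} w swapped =
        off-diagonal (lose (complete e {t} w) (cong (proj₁ ∘ proj₂) (sym swapped)))
    ... | m , n≡1+2m | m′ , n≡2m′ = contradiction (trans (sym n≡2m′) n≡1+2m) (even≢odd m′ m)

    two-squares : ∃ (PositiveRepresentation p)
    two-squares with swap-fixed-windmill
    ... | x , y , w = (x , 2 * y) ,
      windmill-x≥1 {x} {y} {y} w , ≤-trans (windmill-y≥1 {x} {y} {y} w) (m≤m+n y (y + 0)) ,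
      trans (cong (x * x +_) (double-square y)) w
      where double-square : ∀ y → 2 * y * (2 * y) ≡ 4 * y * y
            double-square = solve-∀

module GaussianIntegers where

  open Enumerations
  open import Data.Nat.Base as ℕ using (ℕ)
  import Data.Nat.Divisibility as ℕ
  open import Data.Nat.Primality using (Prime; euclidsLemma; prime⇒nonZero)
  open import Data.Integer.Base using (ℤ; +_; _+_; _*_; _-_; -_) renaming (∣_∣ to abs)
  open import Data.Integer.Properties using (abs-*; *-cancelˡ-≡; *-cancelʳ-≡; pos-*; *-comm)
  open import Data.Integer.Divisibility.Signed
    using (_∣_; divides; ∣⇒∣ᵤ; ∣ᵤ⇒∣; _∣?_; ∣m∣n⇒∣m+n; ∣m+n∣n⇒∣m; ∣n⇒∣m*n)
  open import Data.Integer.Tactic.RingSolver using (solve-∀)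
  open import Data.Product.Base using (_×_; _,_; proj₁; proj₂; ∃-syntax)
  open import Data.Sum.Base as Sum using (_⊎_; inj₁; inj₂)
  open import Function.Base using (_∘_)
  open import Relation.Nullary using (¬_; yes; no; contradiction)
  open import Relation.Binary.PropositionalEquality
    using (_≡_; refl; sym; trans; cong; cong₂; subst; module ≡-Reasoning)

  𝔾 : Set
  𝔾 = ℤ × ℤ

  infixl 7 _·_
  _·_ : 𝔾 → 𝔾 → 𝔾
  (x , y) · (u , v) = x * u - y * v , x * v + y * u

  conj : 𝔾 → 𝔾
  conj (x , y) = x , - y

  norm : 𝔾 → ℤ
  norm (x , y) = x * x + y * y

  scale : ℤ → 𝔾 → 𝔾
  scale c (x , y) = x * c , y * c

  Representation : ℕ → 𝔾 → Set
  Representation n w = norm w ≡ + n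

  norm-· : ∀ z w → norm (z · w) ≡ norm z * norm w
  norm-· (x , y) (u , v) = brahmagupta x y u v
    where
    brahmagupta : ∀ x y u v →
      (x * u - y * v) * (x * u - y * v) + (x * v + y * u) * (x * v + y * u) ≡
      (x * x + y * y) * (u * u + v * v)
    brahmagupta = solve-∀

  norm-conj : ∀ z → norm (conj z) ≡ norm z
  norm-conj (x , y) = square-neg x y
    where
    square-neg : ∀ x y → x * x + (- y) * (- y) ≡ x * x + y * y
    square-neg = solve-∀

  conj-·-· : ∀ z w → conj z · (z · w) ≡ scale (norm z) w
  conj-·-· (a , b) (u , v) = cong₂ _,_ (re a b u v) (im a b u v)
    where
    re : ∀ a b u v → a * (a * u - b * v) - (- b) * (a * v + b * u) ≡ u * (a * a + b * b)
    re = solve-∀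
    im : ∀ a b u v → a * (a * v + b * u) + (- b) * (a * u - b * v) ≡ v * (a * a + b * b)
    im = solve-∀

  ·-conj-· : ∀ z w → z · (conj z · w) ≡ scale (norm z) w
  ·-conj-· (a , b) (u , v) = cong₂ _,_ (re a b u v) (im a b u v)
    where
    re : ∀ a b u v → a * (a * u - (- b) * v) - b * (a * v + (- b) * u) ≡ u * (a * a + b * b)
    re = solve-∀
    im : ∀ a b u v → a * (a * v + (- b) * u) + b * (a * u - (- b) * v) ≡ v * (a * a + b * b)
    im = solve-∀

  ·-scale : ∀ z c w → z · scale c w ≡ scale c (z · w)
  ·-scale (a , b) c (u , v) = cong₂ _,_ (re a b c u v) (im a b c u v)
    where
    re : ∀ a b c u v → a * (u * c) - b * (v * c) ≡ (a * u - b * v) * c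
    re = solve-∀
    im : ∀ a b c u v → a * (v * c) + b * (u * c) ≡ (a * v + b * u) * c
    im = solve-∀

  scale-cancel : ∀ {p} → Prime p → ∀ {z w} → scale (+ p) z ≡ scale (+ p) w → z ≡ w
  scale-cancel {p} p-prime {x , y} {u , v} eq =
    cong₂ _,_ (*-cancelʳ-≡ x u (+ p) (cong proj₁ eq)) (*-cancelʳ-≡ y v (+ p) (cong proj₂ eq))
    where instance _ = prime⇒nonZero p-prime

  euclidsLemmaℤ : ∀ {p} → Prime p → ∀ i j → + p ∣ i * j → + p ∣ i ⊎ + p ∣ j
  euclidsLemmaℤ {p} p-prime i j p∣ij =
    Sum.map ∣ᵤ⇒∣ ∣ᵤ⇒∣
      (euclidsLemma (abs i) (abs j) p-prime (subst (p ℕ.∣_) (abs-* i j) (∣⇒∣ᵤ p∣ij)))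

  module GaussianPrime {p : ℕ} (p-prime : Prime p) {a b : ℤ} (norm-π : norm (a , b) ≡ + p) where

    π : 𝔾
    π = a , b

    -- a decidable stand-in for π ∣ w
    Divisible : 𝔾 → Set
    Divisible w = + p ∣ proj₂ (conj π · w)

    ·-cancelˡ : ∀ {z w} → π · z ≡ π · w → z ≡ w
    ·-cancelˡ {z} {w} eq = scale-cancel p-prime (begin
      scale (+ p) z      ≡⟨ cong (λ c → scale c z) norm-π ⟨
      scale (norm π) z   ≡⟨ conj-·-· π z ⟨
      conj π · (π · z)   ≡⟨ cong (conj π ·_) eq ⟩
      conj π · (π · w)   ≡⟨ conj-·-· π w ⟩
      scale (norm π) w   ≡⟨ cong (λ c → scale c w) norm-π ⟩
      scale (+ p) w      ∎)
      where open ≡-Reasoning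

    representation-· : ∀ {n z} → Representation n z → Representation (p ℕ.* n) (π · z)
    representation-· {n} {z} norm-z = begin
      norm (π · z)      ≡⟨ norm-· π z ⟩
      norm π * norm z   ≡⟨ cong₂ _*_ norm-π norm-z ⟩
      + p * + n         ≡⟨ pos-* p n ⟨
      + (p ℕ.* n)       ∎
      where open ≡-Reasoning

    representation-·⁻¹ : ∀ {n z} → Representation (p ℕ.* n) (π · z) → Representation n z
    representation-·⁻¹ {n} {z} norm-πz = *-cancelˡ-≡ (+ p) (norm z) (+ n) (begin
      + p * norm z      ≡⟨ cong (_* norm z) norm-π ⟨
      norm π * norm z   ≡⟨ norm-· π z ⟨
      norm (π · z)      ≡⟨ norm-πz ⟩
      + (p ℕ.* n)       ≡⟨ pos-* p n ⟩
      + p * + n         ∎)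
      where open ≡-Reasoning
            instance _ = prime⇒nonZero p-prime

    multiple⇒divisible : ∀ z → Divisible (π · z)
    multiple⇒divisible z =
      divides (proj₂ z) (trans (cong proj₂ (conj-·-· π z)) (cong (proj₂ z *_) norm-π))

    -- p divides a · re (conj π · w) = x · norm π + b · im (conj π · w), hence re (conj π · w).
    divisible⇒multiple : ¬ (+ p ∣ a) → ∀ {w} → Divisible w → ∃[ z ] w ≡ π · z
    divisible⇒multiple p∤a {w@(x , y)} (divides q im≡) with euclidsLemmaℤ p-prime a _ p∣a·re
      where
      open ≡-Reasoning
      p∣a·re : + p ∣ a * proj₁ (conj π · w)
      p∣a·re = divides (x + b * q) (begin
        a * (a * x - (- b) * y)                        ≡⟨ re-identity a b x y ⟩
        x * (a * a + b * b) + b * (a * y + (- b) * x)  ≡⟨ cong₂ (λ n i → x * n + b * i) norm-π im≡ ⟩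
        x * + p + b * (q * + p)                        ≡⟨ collect x b q (+ p) ⟩
        (x + b * q) * + p                              ∎)
        where
        re-identity : ∀ a b x y →
          a * (a * x - (- b) * y) ≡ x * (a * a + b * b) + b * (a * y + (- b) * x)
        re-identity = solve-∀
        collect : ∀ x b q p → x * p + b * (q * p) ≡ (x + b * q) * p
        collect = solve-∀
    ... | inj₁ p∣a = contradiction p∣a p∤a
    ... | inj₂ (divides r re≡) = (r , q) , scale-cancel p-prime (begin
      scale (+ p) w                ≡⟨ cong (λ c → scale c w) norm-π ⟨
      scale (norm π) w             ≡⟨ ·-conj-· π w ⟨
      π · (conj π · w)             ≡⟨ cong (π ·_) (cong₂ _,_ re≡ im≡) ⟩
      π · scale (+ p) (r , q)      ≡⟨ ·-scale π (+ p) (r , q) ⟩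
      scale (+ p) (π · (r , q))    ∎)
      where open ≡-Reasoning

    representation-quotient : ¬ (+ p ∣ a) → ∀ {n w} → Representation (p ℕ.* n) w → Divisible w →
                              Image (π ·_) (Representation n) w
    representation-quotient p∤a rep π∣w with divisible⇒multiple p∤a π∣w
    ... | z , refl = z , representation-·⁻¹ rep , refl

  module ConjugatePair {p : ℕ} (p-prime : Prime p) {a b : ℤ} (norm-π : norm (a , b) ≡ + p) where

    module Π = GaussianPrime p-prime {a} {b} norm-π
    module Π̄ = GaussianPrime p-prime {a} { - b} (trans (norm-conj (a , b)) norm-π)
    open Π using (π)
    open Π̄ using () renaming (π to π̄)

    divisible⊎divisible-conj : ∀ {n w} → Representation (p ℕ.* n) w → Π.Divisible w ⊎ Π̄.Divisible w
    divisible⊎divisible-conj {n} {x , y} norm-w =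
      euclidsLemmaℤ p-prime _ _ (divides (y * y - b * b * + n) (begin
        (a * y + (- b) * x) * (a * y + (- - b) * x)       ≡⟨ product a b x y ⟩
        y * y * (a * a + b * b) - b * b * (x * x + y * y) ≡⟨ cong₂ (λ m n → y * y * m - b * b * n)
                                                              norm-π (trans norm-w (pos-* p n)) ⟩
        y * y * + p - b * b * (+ p * + n)                 ≡⟨ collect y b (+ p) (+ n) ⟩
        (y * y - b * b * + n) * + p                       ∎))
      where
      open ≡-Reasoning
      product : ∀ a b x y → (a * y + (- b) * x) * (a * y + (- - b) * x) ≡
                            y * y * (a * a + b * b) - b * b * (x * x + y * y)
      product = solve-∀
      collect : ∀ y b p n → y * y * p - b * b * (p * n) ≡ (y * y - b * b * n) * p
      collect = solve-∀

    module Counting (p∤a : ¬ (+ p ∣ a)) (p∤2 : ¬ (+ p ∣ + 2)) where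

      Representation∤π̄ : ℕ → 𝔾 → Set
      Representation∤π̄ n w = Representation n w × ¬ Π̄.Divisible w

      -- For z = (u , v): 2a · im (conj π̄ · z) = im (conj π̄ · (π · z)) + v · norm π;
      -- so as p ∤ 2a, π̄ ∣ π · z exactly when π̄ ∣ z.
      private
        2a·c≡ : ∀ z → + 2 * a * proj₂ (conj π̄ · z) ≡ proj₂ (conj π̄ · (π · z)) + proj₂ z * + p
        2a·c≡ z@(u , v) =
          trans (identity a b u v) (cong (λ n → proj₂ (conj π̄ · (π · z)) + v * n) norm-π)
          where
          identity : ∀ a b u v → + 2 * a * (a * v + (- - b) * u) ≡
                     a * (a * v + b * u) + (- - b) * (a * u - b * v) + v * (a * a + b * b)
          identity = solve-∀

      conj-divisible-·⁻¹ : ∀ z → Π̄.Divisible (π · z) → Π̄.Divisible z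
      conj-divisible-·⁻¹ z π̄∣πz with euclidsLemmaℤ p-prime _ _ p∣2a·c
        where p∣2a·c = subst (+ p ∣_) (sym (2a·c≡ z)) (∣m∣n⇒∣m+n π̄∣πz (divides (proj₂ z) refl))
      ... | inj₂ π̄∣z = π̄∣z
      ... | inj₁ p∣2a = contradiction p∣2a (Sum.[ p∤2 , p∤a ]′ ∘ euclidsLemmaℤ p-prime (+ 2) a)

      conj-divisible-· : ∀ z → Π̄.Divisible z → Π̄.Divisible (π · z)
      conj-divisible-· z π̄∣z =
        ∣m+n∣n⇒∣m (subst (+ p ∣_) (2a·c≡ z) (∣n⇒∣m*n (+ 2 * a) π̄∣z)) (divides (proj₂ z) refl)

      representations-p* : ∀ {n r s} → Enumeration (Representation n) r →
                           Enumeration (Representation∤π̄ n) s →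
                           Enumeration (Representation (p ℕ.* n)) (r ℕ.+ s)
      representations-p* {n} R S = enumeration-⇔ sound complete
        (enumeration-⊎ disjoint (enumeration-image (π̄ ·_) Π̄.·-cancelˡ R)
                                (enumeration-image (π ·_) Π.·-cancelˡ S))
        where
        disjoint : ∀ {w} → Image (π̄ ·_) (Representation n) w → ¬ Image (π ·_) (Representation∤π̄ n) w
        disjoint (z , _ , refl) (z′ , (_ , π̄∤z′) , πz′≡π̄z) =
          π̄∤z′ (conj-divisible-·⁻¹ z′ (subst Π̄.Divisible (sym πz′≡π̄z) (Π̄.multiple⇒divisible z)))
        sound : ∀ {w} → Image (π̄ ·_) (Representation n) w ⊎ Image (π ·_) (Representation∤π̄ n) w →
                Representation (p ℕ.* n) w
        sound (inj₁ (_ , rep , refl)) = Π̄.representation-· rep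
        sound (inj₂ (_ , (rep , _) , refl)) = Π.representation-· rep
        complete : ∀ {w} → Representation (p ℕ.* n) w →
                   Image (π̄ ·_) (Representation n) w ⊎ Image (π ·_) (Representation∤π̄ n) w
        complete {w} rep with + p ∣? proj₂ (conj π̄ · w) | divisible⊎divisible-conj rep
        ... | yes π̄∣w | _         = inj₁ (Π̄.representation-quotient p∤a rep π̄∣w)
        ... | no π̄∤w  | inj₂ π̄∣w = contradiction π̄∣w π̄∤w
        ... | no π̄∤w  | inj₁ π∣w with Π.representation-quotient p∤a rep π∣w
        ...   | z , rep-z , refl = inj₂ (z , (rep-z , π̄∤w ∘ conj-divisible-· z) , refl)

      representations∤π̄-p* : ∀ {n s} → Enumeration (Representation∤π̄ n) s →
                             Enumeration (Representation∤π̄ (p ℕ.* n)) s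
      representations∤π̄-p* {n} S =
        enumeration-⇔ sound complete (enumeration-image (π ·_) Π.·-cancelˡ S)
        where
        sound : ∀ {w} → Image (π ·_) (Representation∤π̄ n) w → Representation∤π̄ (p ℕ.* n) w
        sound (z , (rep , π̄∤z) , refl) = Π.representation-· rep , π̄∤z ∘ conj-divisible-·⁻¹ z
        complete : ∀ {w} → Representation∤π̄ (p ℕ.* n) w → Image (π ·_) (Representation∤π̄ n) w
        complete (rep , π̄∤w) with divisible⊎divisible-conj rep
        ... | inj₂ π̄∣w = contradiction π̄∣w π̄∤w
        ... | inj₁ π∣w with Π.representation-quotient p∤a rep π∣w
        ...   | z , rep-z , refl = z , (rep-z , π̄∤w ∘ conj-divisible-· z) , refl

      representation⇒∤π̄ : ∀ {n w} → ¬ (p ℕ.∣ n) → Representation n w → ¬ Π̄.Divisible w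
      representation⇒∤π̄ {n} p∤n rep π̄∣w with Π̄.divisible⇒multiple p∤a π̄∣w
      ... | z , refl = p∤n (∣⇒∣ᵤ (divides (norm z) (begin
        + n                ≡⟨ rep ⟨
        norm (π̄ · z)       ≡⟨ norm-· π̄ z ⟩
        norm π̄ * norm z    ≡⟨ cong (_* norm z) (trans (norm-conj π) norm-π) ⟩
        + p * norm z       ≡⟨ *-comm (+ p) (norm z) ⟩
        norm z * + p       ∎)))
        where open ≡-Reasoning

module Representations where

  open Enumerations
  open MultiplicityEnumeration
  open GaussianIntegers
  open Arithmetic using (NonSquare)
  open import Data.Nat.Base as ℕ using (ℕ; suc; s≤s; z≤n)
  import Data.Nat.Divisibility as ℕ
  open import Data.Nat.Properties using (+-identityʳ)
  import Data.Nat.Tactic.RingSolver as ℕ-Solver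
  open import Data.Nat.Primality using (prime[2])
  open import Data.Integer.Base using (ℤ; +_; -[1+_]; _+_; _*_; _-_; -_; _◃_; sign) renaming (∣_∣ to abs)
  open import Data.Integer.Properties using (pos-*; abs-cong; sign-◃; abs-◃)
  import Data.Integer.Properties as ℤ
  open import Data.Integer.Divisibility.Signed using (_∣_; divides; ∣m∣n⇒∣m-n; ∣⇒∣ᵤ)
  open import Data.Integer.Tactic.RingSolver using (solve-∀)
  open import Data.Sign.Base using (Sign)
  open import Data.Product.Base using (_×_; _,_; proj₁; proj₂)
  open import Data.Product.Properties using (≡-dec)
  open import Data.Sum.Base as Sum using (_⊎_; inj₁; inj₂)
  open import Data.List.Base using (List; []; _∷_)
  open import Data.List.Relation.Unary.Any using (here; there)
  open import Data.List.Membership.Propositional using (_∈_)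
  open import Data.List.Relation.Unary.Unique.DecPropositional (≡-dec ℤ._≟_ ℤ._≟_) using (unique?)
  open import Function.Base using (id)
  open import Function.Definitions using (Injective)
  open import Relation.Nullary using (¬_; contradiction)
  open import Relation.Nullary.Decidable using (from-yes)
  open import Relation.Binary.PropositionalEquality using (_≡_; _≢_; refl; sym; trans; cong; cong₂; subst)

  units : List 𝔾
  units = (+ 1 , + 0) ∷ (+ 0 , + 1) ∷ (-[1+ 0 ] , + 0) ∷ (+ 0 , -[1+ 0 ]) ∷ []

  square-abs : ∀ x → x * x ≡ + (abs x ℕ.* abs x)
  square-abs (+ n) = sym (pos-* n n)
  square-abs -[1+ n ] = refl

  norm-abs : ∀ x y → norm (x , y) ≡ + (abs x ℕ.* abs x ℕ.+ abs y ℕ.* abs y)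
  norm-abs x y = cong₂ _+_ (square-abs x) (square-abs y)

  representation-abs : ∀ {n} x y → Representation n (x , y) →
                       abs x ℕ.* abs x ℕ.+ abs y ℕ.* abs y ≡ n
  representation-abs x y rep = cong abs (trans (sym (norm-abs x y)) rep)

  representations-1 : Enumeration (Representation 1) 4
  representations-1 = record
    { elements = units
    ; unique   = from-yes (unique? units)
    ; size     = refl
    ; sound    = λ { (here refl) → refl ; (there (here refl)) → refl
                   ; (there (there (here refl))) → refl ; (there (there (there (here refl)))) → refl }
    ; complete = λ {(x , y)} rep → unit x y (representation-abs x y rep)
    }
    where
    unit : ∀ x y → abs x ℕ.* abs x ℕ.+ abs y ℕ.* abs y ≡ 1 → (x , y) ∈ units
    unit (+ 1) (+ 0) _ = here refl
    unit (+ 0) (+ 1) _ = there (here refl)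
    unit -[1+ 0 ] (+ 0) _ = there (there (here refl))
    unit (+ 0) -[1+ 0 ] _ = there (there (there (here refl)))
    unit (+ 0) (+ 0) ()
    unit (+ 0) (+ suc (suc _)) ()
    unit (+ 0) -[1+ suc _ ] ()
    unit (+ 1) (+ suc _) ()
    unit (+ 1) -[1+ _ ] ()
    unit -[1+ 0 ] (+ suc _) ()
    unit -[1+ 0 ] -[1+ _ ] ()
    unit (+ suc (suc _)) _ ()
    unit -[1+ suc _ ] _ ()

  signed : Sign → Sign → ℕ × ℕ → 𝔾
  signed s t (x , y) = s ◃ x , t ◃ y

  signed-injective : ∀ s t → Injective _≡_ _≡_ (signed s t)
  signed-injective s t eq = cong₂ _,_ (abs-cong (cong proj₁ eq)) (abs-cong (cong proj₂ eq))

  Quadrant : Sign → Sign → ℕ → 𝔾 → Set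
  Quadrant s t N = Image (signed s t) (PositiveRepresentation N)

  quadrant-enumeration : ∀ s t {N c} → Enumeration (PositiveRepresentation N) c →
                         Enumeration (Quadrant s t N) c
  quadrant-enumeration s t = enumeration-image (signed s t) (signed-injective s t)

  quadrant-disjoint : ∀ {s t s′ t′ N w} → (s , t) ≢ (s′ , t′) →
                      Quadrant s t N w → ¬ Quadrant s′ t′ N w
  quadrant-disjoint {s} {t} {s′} {t′} st≢s′t′
    ((suc x , suc y) , (s≤s _ , s≤s _ , _) , refl) ((suc x′ , suc y′) , (s≤s _ , s≤s _ , _) , eq) =
    st≢s′t′ (cong₂ _,_ (sign-of (cong proj₁ eq)) (sign-of (cong proj₂ eq)))
    where
    sign-of : ∀ {s s′ m m′} → s′ ◃ suc m′ ≡ s ◃ suc m → s ≡ s′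
    sign-of {s} {s′} {m} {m′} eq =
      trans (sym (sign-◃ s (suc m))) (trans (cong sign (sym eq)) (sign-◃ s′ (suc m′)))

  quadrant⇒representation : ∀ {s t N w} → Quadrant s t N w → Representation N w
  quadrant⇒representation {s} {t} ((x , y) , (_ , _ , x²+y²≡N) , refl) =
    trans (norm-abs (s ◃ x) (t ◃ y))
          (cong +_ (trans (cong₂ (λ m n → m ℕ.* m ℕ.+ n ℕ.* n) (abs-◃ s x) (abs-◃ t y)) x²+y²≡N))

  representations-fourfold : ∀ {N c} → NonSquare N → Enumeration (PositiveRepresentation N) c →
                             Enumeration (Representation N) (4 ℕ.* c)
  representations-fourfold {N} {c} N-nonsquare E =
    subst (Enumeration (Representation N)) (c+[c+[c+c]]≡4c c) (enumeration-⇔ sound complete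
      (enumeration-⊎ (λ q → Sum.[ quadrant-disjoint (λ ()) q ,
                                 Sum.[ quadrant-disjoint (λ ()) q , quadrant-disjoint (λ ()) q ]′ ]′)
        (quadrant-enumeration Sign.+ Sign.+ E)
      (enumeration-⊎ (λ q → Sum.[ quadrant-disjoint (λ ()) q , quadrant-disjoint (λ ()) q ]′)
        (quadrant-enumeration Sign.- Sign.+ E)
      (enumeration-⊎ (quadrant-disjoint (λ ()))
        (quadrant-enumeration Sign.- Sign.- E)
        (quadrant-enumeration Sign.+ Sign.- E)))))
    where
    c+[c+[c+c]]≡4c : ∀ c → c ℕ.+ (c ℕ.+ (c ℕ.+ c)) ≡ 4 ℕ.* c
    c+[c+[c+c]]≡4c = ℕ-Solver.solve-∀
    Quadrants : 𝔾 → Set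
    Quadrants w = Quadrant Sign.+ Sign.+ N w ⊎ Quadrant Sign.- Sign.+ N w ⊎
                  Quadrant Sign.- Sign.- N w ⊎ Quadrant Sign.+ Sign.- N w
    in-quadrant : ∀ s t {x y} → suc x ℕ.* suc x ℕ.+ suc y ℕ.* suc y ≡ N →
                  Quadrant s t N (signed s t (suc x , suc y))
    in-quadrant s t {x} {y} x²+y²≡N = (suc x , suc y) , (s≤s z≤n , s≤s z≤n , x²+y²≡N) , refl
    sound : ∀ {w} → Quadrants w → Representation N w
    sound = Sum.[ quadrant⇒representation , Sum.[ quadrant⇒representation ,
                  Sum.[ quadrant⇒representation , quadrant⇒representation ]′ ]′ ]′
    complete : ∀ {w} → Representation N w → Quadrants w
    complete {+ 0 , y} rep = contradiction (representation-abs (+ 0) y rep) (N-nonsquare (abs y))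
    complete {x , + 0} rep =
      contradiction (trans (sym (+-identityʳ _)) (representation-abs x (+ 0) rep)) (N-nonsquare (abs x))
    complete {x′@(+ suc x) , y′@(+ suc y)} rep =
      inj₁ (in-quadrant Sign.+ Sign.+ (representation-abs x′ y′ rep))
    complete {x′@(-[1+ x ]) , y′@(+ suc y)} rep =
      inj₂ (inj₁ (in-quadrant Sign.- Sign.+ (representation-abs x′ y′ rep)))
    complete {x′@(-[1+ x ]) , y′@(-[1+ y ])} rep =
      inj₂ (inj₂ (inj₁ (in-quadrant Sign.- Sign.- (representation-abs x′ y′ rep))))
    complete {x′@(+ suc x) , y′@(-[1+ y ])} rep =
      inj₂ (inj₂ (inj₂ (in-quadrant Sign.+ Sign.- (representation-abs x′ y′ rep))))

  representations-2* : ∀ {m r} → Enumeration (Representation m) r →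
                       Enumeration (Representation (2 ℕ.* m)) r
  representations-2* {m} R =
    enumeration-⇔ sound complete (enumeration-image (Π.π ·_) Π.·-cancelˡ R)
    where
    open ConjugatePair prime[2] {+ 1} {+ 1} refl
    2∤1 : ¬ (+ 2 ∣ + 1)
    2∤1 2∣1 with ℕ.∣1⇒≡1 (∣⇒∣ᵤ 2∣1)
    ... | ()
    -- 1 - i and 1 + i are associates
    conj⇒ : ∀ {w} → Π̄.Divisible w → Π.Divisible w
    conj⇒ {x , y} 2∣y+x = subst (+ 2 ∣_) (y+x-2x x y) (∣m∣n⇒∣m-n 2∣y+x (divides x refl))
      where
      y+x-2x : ∀ x y → (+ 1 * y + + 1 * x) - x * + 2 ≡ + 1 * y + (- + 1) * x
      y+x-2x = solve-∀
    sound : ∀ {w} → Image (Π.π ·_) (Representation m) w → Representation (2 ℕ.* m) w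
    sound (z , rep , refl) = Π.representation-· {m} {z} rep
    complete : ∀ {w} → Representation (2 ℕ.* m) w → Image (Π.π ·_) (Representation m) w
    complete {w} rep = Π.representation-quotient 2∤1 {m} {w} rep
                         (Sum.[ id , conj⇒ {w} ]′ (divisible⊎divisible-conj {m} {w} rep))

module MultiplicityFormulas where

  open import Defs
  open Enumerations
  open MultiplicityEnumeration
  open Arithmetic
  open GaussianIntegers
  open Representations
  open TwoSquares using (module Windmills)
  open import Data.Nat.Base using (ℕ; zero; suc; _+_; _*_; _%_; _^_; _≤_)
  open import Data.Nat.Divisibility using (_∣_; ∣-refl)
  open import Data.Nat.Properties using (*-cancelˡ-≡)
  open import Data.Nat.Primality using (Prime; prime[2])
  open import Data.Nat.Tactic.RingSolver using (solve-∀)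
  open import Data.Integer.Base using (+_)
  open import Data.Integer.Divisibility.Signed using (∣⇒∣ᵤ)
  open import Data.Product.Base using (_,_; proj₁)
  open import Function.Base using (_∘_; case_of_)
  open import Relation.Nullary using (¬_)
  open import Relation.Binary.PropositionalEquality using (_≡_; _≢_; trans; cong; subst)

  module SplitPrime {p : ℕ} (p-prime : Prime p) (p≡1mod4 : p % 4 ≡ 1)
                    {a b : ℕ} (a≥1 : 1 ≤ a) (b≥1 : 1 ≤ b) (a²+b²≡p : a * a + b * b ≡ p) where

    open ConjugatePair p-prime {+ a} {+ b} (trans (norm-abs (+ a) (+ b)) (cong +_ a²+b²≡p))
    open Counting (square-summand-∤ a≥1 b≥1 a²+b²≡p ∘ ∣⇒∣ᵤ) (≡1mod4⇒∤2 p-prime p≡1mod4 ∘ ∣⇒∣ᵤ)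

    representations∤π̄-coprime : ∀ {n r} → ¬ (p ∣ n) → Enumeration (Representation n) r →
                                Enumeration (Representation∤π̄ n) r
    representations∤π̄-coprime p∤n =
      enumeration-⇔ (λ rep → rep , representation⇒∤π̄ p∤n rep) proj₁

    representations-p*-coprime : ∀ {n r} → ¬ (p ∣ n) → Enumeration (Representation n) r →
                                 Enumeration (Representation (p * n)) (r + r)
    representations-p*-coprime p∤n R = representations-p* R (representations∤π̄-coprime p∤n R)

    representations∤π̄-p^ : ∀ k → Enumeration (Representation∤π̄ (p ^ k)) 4
    representations∤π̄-p^ zero =
      representations∤π̄-coprime (prime∤1 p-prime) representations-1
    representations∤π̄-p^ (suc k) = representations∤π̄-p* (representations∤π̄-p^ k)

    representations-p^ : ∀ k → Enumeration (Representation (p ^ k)) (4 * suc k)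
    representations-p^ zero = representations-1
    representations-p^ (suc k) =
      subst (Enumeration (Representation (p ^ suc k))) (4[1+k]+4≡4[2+k] k)
        (representations-p* (representations-p^ k) (representations∤π̄-p^ k))
      where 4[1+k]+4≡4[2+k] : ∀ k → 4 * suc k + 4 ≡ 4 * suc (suc k)
            4[1+k]+4≡4[2+k] = solve-∀

  module _ {p : ℕ} (p-prime : Prime p) (p≡1mod4 : p % 4 ≡ 1) where

    representations-p^ : ∀ k → Enumeration (Representation (p ^ k)) (4 * suc k)
    representations-p^ = case Windmills.two-squares p-prime p≡1mod4 of λ
      { (_ , a≥1 , b≥1 , a²+b²≡p) →
          SplitPrime.representations-p^ p-prime p≡1mod4 a≥1 b≥1 a²+b²≡p }

    representations-p*-coprime : ∀ {n r} → ¬ (p ∣ n) → Enumeration (Representation n) r →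
                                 Enumeration (Representation (p * n)) (r + r)
    representations-p*-coprime = case Windmills.two-squares p-prime p≡1mod4 of λ
      { (_ , a≥1 , b≥1 , a²+b²≡p) →
          SplitPrime.representations-p*-coprime p-prime p≡1mod4 a≥1 b≥1 a²+b²≡p }

  multiplicity-from-representations : ∀ {N c} → NonSquare N →
                                      Enumeration (Representation N) (4 * c) → multiplicity N ≡ c
  multiplicity-from-representations {N} N-nonsquare R = *-cancelˡ-≡ _ _ 4
    (size-unique (representations-fourfold N-nonsquare (multiplicity-enumeration N)) R)

  multiplicity-p₁p₂^ : ∀ {p₁ p₂} → Prime p₁ → Prime p₂ → p₁ ≢ p₂ → p₁ % 4 ≡ 1 → p₂ % 4 ≡ 1 →
                       ∀ k → multiplicity (p₁ * p₂ ^ k) ≡ 2 * suc k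
  multiplicity-p₁p₂^ p₁-prime p₂-prime p₁≢p₂ p₁≡1mod4 p₂≡1mod4 k =
    multiplicity-from-representations (prime*∤⇒nonSquare p₁-prime p₁∤p₂^k)
      (subst (Enumeration _) (4[1+k]+4[1+k]≡4[2[1+k]] k)
        (representations-p*-coprime p₁-prime p₁≡1mod4 p₁∤p₂^k
          (representations-p^ p₂-prime p₂≡1mod4 k)))
    where
    p₁∤p₂^k = p₁≢p₂ ∘ prime∣prime^⇒≡ p₁-prime p₂-prime k
    4[1+k]+4[1+k]≡4[2[1+k]] : ∀ k → 4 * suc k + 4 * suc k ≡ 4 * (2 * suc k)
    4[1+k]+4[1+k]≡4[2[1+k]] = solve-∀

  multiplicity-2p^2k : ∀ {p} → Prime p → p % 4 ≡ 1 →
                       ∀ k → multiplicity (2 * p ^ (2 * k)) ≡ suc (2 * k)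
  multiplicity-2p^2k p-prime p≡1mod4 k =
    multiplicity-from-representations (prime*∤⇒nonSquare prime[2] 2∤p^2k)
      (representations-2* (representations-p^ p-prime p≡1mod4 (2 * k)))
    where
    2∤p^2k : ¬ (2 ∣ _)
    2∤p^2k 2∣p^2k = ≡1mod4⇒∤2 p-prime p≡1mod4
      (subst (_∣ 2) (prime∣prime^⇒≡ prime[2] p-prime (2 * k) 2∣p^2k) ∣-refl)

open import Defs
open import Data.Nat using (ℕ; _*_; _^_; _∸_; _%_; _≤_; suc)
open import Data.Nat.Primality using (Prime; prime?)
open import Data.Product using (_×_; _,_; ∃-syntax)
open import Relation.Nullary.Decidable using (from-yes)
open import Relation.Binary.PropositionalEquality using (_≡_; _≢_; refl)
open MultiplicityEnumeration using (multiplicity-suc⇒eigenvalue)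
open MultiplicityFormulas using (multiplicity-p₁p₂^; multiplicity-2p^2k)

theorem2p1 :
    ((k : ℕ) → 1 ≤ k →
      (∃[ N ] (IsEigenvalue N × multiplicity N ≡ 2 * k))
      × ((p₁ p₂ : ℕ) → Prime p₁ → Prime p₂ → p₁ ≢ p₂ → p₁ % 4 ≡ 1 → p₂ % 4 ≡ 1 →
          IsEigenvalue (p₁ * p₂ ^ (k ∸ 1)) × multiplicity (p₁ * p₂ ^ (k ∸ 1)) ≡ 2 * k))
    × ((k : ℕ) → 1 ≤ k →
      (∃[ M ] (IsEigenvalue M × multiplicity M ≡ suc (2 * k)))
      × ((p : ℕ) → Prime p → p % 4 ≡ 1 →
          IsEigenvalue (2 * p ^ (2 * k)) × multiplicity (2 * p ^ (2 * k)) ≡ suc (2 * k)))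
theorem2p1 =
  (λ k 1≤k → (_ , part-i k 1≤k 5 13 prime[5] prime[13] (λ ()) refl refl) , part-i k 1≤k) ,
  (λ k _ → (_ , part-ii k 5 prime[5] refl) , part-ii k)
  where
  prime[5] : Prime 5
  prime[5] = from-yes (prime? 5)
  prime[13] : Prime 13
  prime[13] = from-yes (prime? 13)
  part-i : ∀ k → 1 ≤ k → (p₁ p₂ : ℕ) → Prime p₁ → Prime p₂ → p₁ ≢ p₂ → p₁ % 4 ≡ 1 → p₂ % 4 ≡ 1 →
           IsEigenvalue (p₁ * p₂ ^ (k ∸ 1)) × multiplicity (p₁ * p₂ ^ (k ∸ 1)) ≡ 2 * k
  part-i (suc k) _ _ _ p₁-prime p₂-prime p₁≢p₂ p₁≡1mod4 p₂≡1mod4 =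
    let mult = multiplicity-p₁p₂^ p₁-prime p₂-prime p₁≢p₂ p₁≡1mod4 p₂≡1mod4 k
    in multiplicity-suc⇒eigenvalue mult , mult
  part-ii : ∀ k (p : ℕ) → Prime p → p % 4 ≡ 1 →
            IsEigenvalue (2 * p ^ (2 * k)) × multiplicity (2 * p ^ (2 * k)) ≡ suc (2 * k)
  part-ii k _ p-prime p≡1mod4 =
    let mult = multiplicity-2p^2k p-prime p≡1mod4 k
    in multiplicity-suc⇒eigenvalue mult , mult
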